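{- Let $(E,\mathcal{C})$ be an alignment. Then $(E,\mathcal{C})$ is a convex geometry if and only if, for all subsets $X,Y\subseteq E$ such that $Y$ induces a cycle on $X$, we have $Y\subseteq \sigma(X)$.
   Context: A set system is a pair $(E,\mathcal{C})$ with $E$ a finite set and $\mathcal{C}$ a collection of subsets of $E$ (called convex sets). It is an alignment if $E\in\mathcal{C}$, $\varnothing\in\mathcal{C}$, and $\mathcal{C}$ is closed under intersections. For $U\subseteq E$ write $\sigma(U)=\bigcap\{J\in\mathcal{C}: U\subseteq J\}$, and write $x+Y$ for $Y\cup\{x\}$. A convex geometry is an alignment satisfying the anti-exchange property: for every $Y\in\mathcal{C}$ and all distinct $x,z\notin Y$, if $z\in\sigma(x+Y)$ then $x\notin\sigma(z+Y)$. For $X,Y\subseteq E$ with $Y=\{y_1,\dots,y_k\}$, $k\ge 2$, the set $Y$ induces a cycle on $X$ if (for this enumeration of $Y$) $y_{i+1}\in\sigma(y_i+X)$ for all $i<k$ and $y_1\in\sigma(y_k+X)$. -}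

module Defs where

open import Data.Nat using (ℕ; suc)
open import Data.Fin using (Fin; zero; suc; inject₁; fromℕ)
open import Data.Fin.Subset using (Subset; _∈_; _∉_; _⊆_; _∩_; _∪_; ⁅_⁆; ⊤; ⊥)
open import Data.Product using (Σ; ∃; _×_)
open import Relation.Binary.PropositionalEquality using (_≡_; _≢_)
open import Relation.Nullary using (¬_)
open import Function.Definitions using (Injective)

-- Ground set E = Fin n; a set system is a predicate 𝒞 on subsets of E
-- (𝒞 J means "J is convex").

_+ₛ_ : ∀ {n} → Fin n → Subset n → Subset n
x +ₛ Y = ⁅ x ⁆ ∪ Y

-- Alignment: E ∈ 𝒞, ∅ ∈ 𝒞, closed under intersections
-- (for a finite family, closure under binary intersections; the empty
-- intersection is E).
record IsAlignment {n : ℕ} (𝒞 : Subset n → Set) : Set where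
  field
    full  : 𝒞 ⊤
    empty : 𝒞 ⊥
    inter : ∀ J K → 𝒞 J → 𝒞 K → 𝒞 (J ∩ K)

_∈σ[_]_ : ∀ {n} → Fin n → (Subset n → Set) → Subset n → Set
x ∈σ[ 𝒞 ] U = ∀ J → 𝒞 J → U ⊆ J → x ∈ J

_⊆σ[_]_ : ∀ {n} → Subset n → (Subset n → Set) → Subset n → Set
U ⊆σ[ 𝒞 ] V = ∀ x → x ∈ U → x ∈σ[ 𝒞 ] V

AntiExchange : ∀ {n} → (Subset n → Set) → Set
AntiExchange {n} 𝒞 =
  ∀ (Y : Subset n) → 𝒞 Y → ∀ (x z : Fin n) → x ≢ z → x ∉ Y → z ∉ Y →
  z ∈σ[ 𝒞 ] (x +ₛ Y) → ¬ (x ∈σ[ 𝒞 ] (z +ₛ Y))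

IsConvexGeometry : ∀ {n} → (Subset n → Set) → Set
IsConvexGeometry 𝒞 = IsAlignment 𝒞 × AntiExchange 𝒞

-- Y induces a cycle on X: there is an enumeration y₀,…,y_{k-1} of Y
-- (k = m + 2 ≥ 2, pairwise distinct, image exactly Y) with
-- y_{i+1} ∈ σ(y_i + X) for i < k-1, and y₀ ∈ σ(y_{k-1} + X).
InducesCycle : ∀ {n} → (Subset n → Set) → Subset n → Subset n → Set
InducesCycle {n} 𝒞 X Y =
  Σ ℕ λ m → Σ (Fin (suc (suc m)) → Fin n) λ ys →
    Injective _≡_ _≡_ ys ×
    (∀ y → y ∈ Y → ∃ λ i → ys i ≡ y) ×
    (∀ i → ys i ∈ Y) ×
    (∀ (i : Fin (suc m)) → ys (suc i) ∈σ[ 𝒞 ] (ys (inject₁ i) +ₛ X)) ×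
    (ys zero ∈σ[ 𝒞 ] (ys (fromℕ (suc m)) +ₛ X))

module Submission where

open import Defs
open import Data.Nat using (ℕ; suc)
open import Data.Fin using (Fin; zero; suc; inject₁; fromℕ)
open import Data.Fin.Subset using (Subset; _∈_; _⊆_; _∪_; ⁅_⁆)
open import Data.Fin.Subset.Properties
  using (x∈⁅x⁆; x∈⁅y⁆⇒x≡y; x∈p∪q⁻; x∈p∪q⁺; q⊆p∪q; _∈?_)
open import Data.Product using (∃; _,_)
open import Data.Sum using (inj₁; inj₂)
open import Data.Empty using (⊥-elim)
open import Relation.Nullary.Decidable using (decidable-stable)
open import Relation.Binary.PropositionalEquality using (_≡_; _≢_; refl; sym; subst)
open import Function.Bundles using (_⇔_; mk⇔)

-- Over a fixed set J, the relation "b ∈ σ(a + J)" is a preorder,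
-- it grows with J, and a convex J is closed under it. If Y induces a cycle on
-- X and J ⊇ X is convex, any two elements of the cycle are related over J;
-- the first two are distinct, so by anti-exchange they cannot both lie
-- outside J, hence the whole cycle lies in J. Conversely, a violation of
-- anti-exchange at a convex Y with points x, z is exactly a two-element
-- cycle {x, z} on Y not contained in σ(Y) = Y.

module _ {n : ℕ} where

  ∈-+ₛ : (a : Fin n) (J : Subset n) → a ∈ a +ₛ J
  ∈-+ₛ a J = x∈p∪q⁺ (inj₁ (x∈⁅x⁆ a))

  ⊆-+ₛ : (a : Fin n) (J : Subset n) → J ⊆ a +ₛ J
  ⊆-+ₛ a J = q⊆p∪q ⁅ a ⁆ J

  +ₛ-⊆ : ∀ {a : Fin n} {J L : Subset n} → a ∈ L → J ⊆ L → a +ₛ J ⊆ L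
  +ₛ-⊆ {a} {J} a∈L J⊆L p with x∈p∪q⁻ ⁅ a ⁆ J p
  ... | inj₁ q = subst (_∈ _) (sym (x∈⁅y⁆⇒x≡y a q)) a∈L
  ... | inj₂ q = J⊆L q

module Closure {n : ℕ} (𝒞 : Subset n → Set) where

  _⇝⟨_⟩_ : Fin n → Subset n → Fin n → Set
  a ⇝⟨ J ⟩ b = b ∈σ[ 𝒞 ] (a +ₛ J)

  ⇝-refl : ∀ {J} a → a ⇝⟨ J ⟩ a
  ⇝-refl {J} a L _ a+J⊆L = a+J⊆L (∈-+ₛ a J)

  ⇝-trans : ∀ {J a b c} → a ⇝⟨ J ⟩ b → b ⇝⟨ J ⟩ c → a ⇝⟨ J ⟩ c
  ⇝-trans {J} {a} a⇝b b⇝c L 𝒞L a+J⊆L =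
    b⇝c L 𝒞L (+ₛ-⊆ (a⇝b L 𝒞L a+J⊆L) (λ p → a+J⊆L (⊆-+ₛ a J p)))

  ⇝-mono : ∀ {X J a b} → X ⊆ J → a ⇝⟨ X ⟩ b → a ⇝⟨ J ⟩ b
  ⇝-mono {X} {J} {a} X⊆J a⇝b L 𝒞L a+J⊆L =
    a⇝b L 𝒞L (+ₛ-⊆ (a+J⊆L (∈-+ₛ a J)) (λ p → a+J⊆L (⊆-+ₛ a J (X⊆J p))))

  ⇝-closed : ∀ {J a b} → 𝒞 J → a ∈ J → a ⇝⟨ J ⟩ b → b ∈ J
  ⇝-closed 𝒞J a∈J a⇝b = a⇝b _ 𝒞J (+ₛ-⊆ a∈J (λ p → p))

  ⇝-path : ∀ {J} m (f : Fin (suc m) → Fin n) →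
    (∀ i → f (inject₁ i) ⇝⟨ J ⟩ f (suc i)) → ∀ j → f zero ⇝⟨ J ⟩ f j
  ⇝-path m       f steps zero    = ⇝-refl (f zero)
  ⇝-path (suc m) f steps (suc j) =
    ⇝-trans (steps zero) (⇝-path m (λ i → f (suc i)) (λ i → steps (suc i)) j)

  mutual-⇝⇒∈ : AntiExchange 𝒞 → ∀ {J a b} → 𝒞 J → a ≢ b →
    a ⇝⟨ J ⟩ b → b ⇝⟨ J ⟩ a → a ∈ J
  mutual-⇝⇒∈ ae {J} {a} {b} 𝒞J a≢b a⇝b b⇝a = decidable-stable (a ∈? J) λ a∉J →
    ae J 𝒞J a b a≢b a∉J (λ b∈J → a∉J (⇝-closed 𝒞J b∈J b⇝a)) a⇝b b⇝a

  cycle-⊆σ : AntiExchange 𝒞 → ∀ X Y → InducesCycle 𝒞 X Y → Y ⊆σ[ 𝒞 ] X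
  cycle-⊆σ ae X Y (m , ys , ys-inj , ys-onto , _ , step , close) y y∈Y J 𝒞J X⊆J
    with ys-onto y y∈Y
  ... | i , refl = ⇝-closed 𝒞J head∈J (⇝-path (suc m) ys step′ i)
    where
    step′ : ∀ k → ys (inject₁ k) ⇝⟨ J ⟩ ys (suc k)
    step′ k = ⇝-mono X⊆J (step k)

    second⇝head : ys (suc zero) ⇝⟨ J ⟩ ys zero
    second⇝head = ⇝-trans (⇝-path m (λ k → ys (suc k)) (λ k → step′ (suc k)) (fromℕ m))
                          (⇝-mono X⊆J close)

    head≢second : ys zero ≢ ys (suc zero)
    head≢second e with ys-inj e
    ... | ()

    head∈J : ys zero ∈ J
    head∈J = mutual-⇝⇒∈ ae 𝒞J head≢second (step′ zero) second⇝head

  pair-inducesCycle : ∀ {X x z} → x ≢ z → x ⇝⟨ X ⟩ z → z ⇝⟨ X ⟩ x →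
    InducesCycle 𝒞 X (⁅ x ⁆ ∪ ⁅ z ⁆)
  pair-inducesCycle {X} {x} {z} x≢z x⇝z z⇝x = 0 , ys , ys-inj , ys-onto , ys-in , step , z⇝x
    where
    ys : Fin 2 → Fin n
    ys zero       = x
    ys (suc zero) = z

    ys-inj : ∀ {i j} → ys i ≡ ys j → i ≡ j
    ys-inj {zero}     {zero}     _ = refl
    ys-inj {zero}     {suc zero} e = ⊥-elim (x≢z e)
    ys-inj {suc zero} {zero}     e = ⊥-elim (x≢z (sym e))
    ys-inj {suc zero} {suc zero} _ = refl

    ys-onto : ∀ y → y ∈ ⁅ x ⁆ ∪ ⁅ z ⁆ → ∃ λ i → ys i ≡ y
    ys-onto y p with x∈p∪q⁻ ⁅ x ⁆ ⁅ z ⁆ p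
    ... | inj₁ q = zero , sym (x∈⁅y⁆⇒x≡y x q)
    ... | inj₂ q = suc zero , sym (x∈⁅y⁆⇒x≡y z q)

    ys-in : ∀ i → ys i ∈ ⁅ x ⁆ ∪ ⁅ z ⁆
    ys-in zero       = x∈p∪q⁺ (inj₁ (x∈⁅x⁆ x))
    ys-in (suc zero) = x∈p∪q⁺ (inj₂ (x∈⁅x⁆ z))

    step : ∀ (i : Fin 1) → ys (suc i) ∈σ[ 𝒞 ] (ys (inject₁ i) +ₛ X)
    step zero = x⇝z

  cycles-⊆σ⇒antiExchange : (∀ X Y → InducesCycle 𝒞 X Y → Y ⊆σ[ 𝒞 ] X) → AntiExchange 𝒞
  cycles-⊆σ⇒antiExchange H Y 𝒞Y x z x≢z x∉Y _ x⇝z z⇝x =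
    x∉Y (H Y _ (pair-inducesCycle x≢z x⇝z z⇝x) x (x∈p∪q⁺ (inj₁ (x∈⁅x⁆ x))) Y 𝒞Y (λ p → p))

lemma2p2 : (n : ℕ) (𝒞 : Subset n → Set) → IsAlignment 𝒞 →
    (IsConvexGeometry 𝒞 ⇔ (∀ (X Y : Subset n) → InducesCycle 𝒞 X Y → Y ⊆σ[ 𝒞 ] X))
lemma2p2 n 𝒞 alignment = mk⇔
  (λ (_ , ae) → cycle-⊆σ ae)
  (λ H → alignment , cycles-⊆σ⇒antiExchange H)
  where open Closure 𝒞
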